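{- Every tree-like $\mathrm{Res}(\oplus)$ refutation of $\mathrm{Ordering}_n$ has size at least $2^{n-2}$, and every $\mathrm{Res}(\oplus)$ refutation of $\mathrm{Ordering}_n$ has space at least $n-2$.
   Context: $\mathrm{Ordering}_n$ is the CNF in the variables $(x_{ij})_{i\neq j\in[n]}$ consisting of: $\neg x_{ij}\lor\neg x_{ji}$ for $i\neq j$; $x_{ij}\lor x_{ji}$ for $i\ne j$; $\neg x_{ij}\lor\neg x_{jk}\lor x_{ik}$ for distinct $i,j,k$; $\bigvee_{j\in[n]\setminus\{i\}} x_{ji}$ for each $i\in[n]$. It is viewed as a linear CNF by writing $x$ as $(x=1)$ and $\neg x$ as $(x=0)$. Linear clauses are disjunctions of equations $f=\alpha$ with $f$ a linear form over $\mathbb{F}_2$, $\alpha\in\{0,1\}$. $\mathrm{Res}(\oplus)$ has the rules: from $A\lor(f=0)$ and $B\lor(f=1)$ derive $A\lor B$; from $C$ derive any linear clause $D$ semantically implied by $C$. A refutation derives the empty clause from the clauses of the formula; it is tree-like if it can be arranged as a binary tree (root: empty clause, leaves: formula clauses, internal nodes: results of rule applications to their children), and its size is its number of clauses. Space: a refutation is a sequence of configurations (sets of linear clauses) $S_1=\emptyset,\dots,S_t\ni$ empty clause, each obtained from the previous by adding a formula clause, deleting a clause, or adding a clause deduced from the current clauses by the rules; its space is $\max_i|S_i|$. -}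

module Defs where

open import Data.Nat using (ℕ; zero; suc; _+_; _⊔_)
open import Data.Bool using (Bool; true; false; _∧_; _xor_; not; if_then_else_)
open import Data.Fin using (Fin; _≟_)
open import Data.List using (List; []; _∷_; _++_; foldr; map; filter; length; allFin)
open import Data.List.Membership.Propositional using (_∈_)
open import Data.List.Relation.Unary.Any using (Any)
open import Data.List.Relation.Unary.All using (All)
open import Data.List.Relation.Binary.Subset.Propositional using (_⊆_)
open import Data.Vec using (Vec; lookup; tabulate)
open import Data.Product using (_×_; _,_; proj₁; proj₂)
open import Relation.Nullary using (¬_; does; ¬?)
open import Relation.Binary.PropositionalEquality using (_≡_; _≢_)

-- Variables x_ij (i ≠ j ∈ [n]) are indexed by pairs (i , j) of Fin n.
-- A linear form over F₂ is its coefficient matrix; diagonal entries do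
-- not correspond to variables and are required to be 0 (see WF below)
-- and are ignored by evaluation.

Form : ℕ → Set
Form n = Vec (Vec Bool n) n

coef : ∀ {n} → Form n → Fin n → Fin n → Bool
coef f i j = lookup (lookup f i) j

WFForm : ∀ {n} → Form n → Set
WFForm {n} f = ∀ (i : Fin n) → coef f i i ≡ false

Assign : ℕ → Set
Assign n = Fin n → Fin n → Bool

sumOffDiag : ∀ {n} → (Fin n → Fin n → Bool) → Bool
sumOffDiag {n} g =
  foldr (λ i acc → foldr (λ j acc' → (if does (i ≟ j) then false else g i j) xor acc')
                         acc (allFin n))
        false (allFin n)

eval : ∀ {n} → Form n → Assign n → Bool
eval f a = sumOffDiag (λ i j → coef f i j ∧ a i j)

Eqn : ℕ → Set
Eqn n = Form n × Bool

-- linear clause: disjunction of linear equations (a list read as a set)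
Clause : ℕ → Set
Clause n = List (Eqn n)

WFClause : ∀ {n} → Clause n → Set
WFClause C = All (λ e → WFForm (proj₁ e)) C

Sat : ∀ {n} → Assign n → Clause n → Set
Sat a C = Any (λ e → eval (proj₁ e) a ≡ proj₂ e) C

_⊨_ : ∀ {n} → Clause n → Clause n → Set
_⊨_ {n} C D = ∀ (a : Assign n) → Sat a C → Sat a D

-- resolution: from C₁ = A ∨ (f = 0) and C₂ = B ∨ (f = 1) derive D = A ∨ B
-- (as sets of equations: D = A ∪ B for some A, B with C₁ = A ∪ {f=0},
--  C₂ = B ∪ {f=1})
record ResStep {n} (f : Form n) (C₁ C₂ D : Clause n) : Set where
  field
    f0∈C₁ : (f , false) ∈ C₁
    f1∈C₂ : (f , true) ∈ C₂
    C₁⊆   : C₁ ⊆ ((f , false) ∷ D)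
    C₂⊆   : C₂ ⊆ ((f , true) ∷ D)
    D⊆    : D ⊆ (C₁ ++ C₂)

var : ∀ {n} → Fin n → Fin n → Form n
var i j = tabulate (λ a → tabulate (λ b → does (a ≟ i) ∧ does (b ≟ j)))

pos neg : ∀ {n} → Fin n → Fin n → Eqn n
pos i j = (var i j , true)
neg i j = (var i j , false)

data Ordering {n : ℕ} : Clause n → Set where
  antisym : ∀ (i j : Fin n) → i ≢ j → Ordering (neg i j ∷ neg j i ∷ [])
  total   : ∀ (i j : Fin n) → i ≢ j → Ordering (pos i j ∷ pos j i ∷ [])
  trans   : ∀ (i j k : Fin n) → i ≢ j → j ≢ k → i ≢ k →
            Ordering (neg i j ∷ neg j k ∷ pos i k ∷ [])
  nomin   : ∀ (i : Fin n) →
            Ordering (map (λ j → pos j i) (filter (λ j → ¬? (j ≟ i)) (allFin n)))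

data TreeDeriv {n : ℕ} : Clause n → Set where
  axiom : ∀ {C} → Ordering C → TreeDeriv C
  res   : ∀ {f C₁ C₂ D} → TreeDeriv C₁ → TreeDeriv C₂ → ResStep f C₁ C₂ D → TreeDeriv D
  weak  : ∀ {C D} → TreeDeriv C → C ⊨ D → WFClause D → TreeDeriv D

size : ∀ {n} {C : Clause n} → TreeDeriv C → ℕ
size (axiom _)     = 1
size (res p q _)   = suc (size p + size q)
size (weak p _ _)  = suc (size p)

TreeRefutation : ℕ → Set
TreeRefutation n = TreeDeriv {n} []

Config : ℕ → Set
Config n = List (Clause n)

data Step {n : ℕ} : Config n → Config n → Set where
  addAx  : ∀ {S C} → Ordering C → Step S (C ∷ S)
  delete : ∀ (S₁ S₂ : Config n) (C : Clause n) → Step (S₁ ++ C ∷ S₂) (S₁ ++ S₂)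
  addRes : ∀ {S f C₁ C₂ D} → C₁ ∈ S → C₂ ∈ S → ResStep f C₁ C₂ D → Step S (D ∷ S)
  addWk  : ∀ {S C D} → C ∈ S → C ⊨ D → WFClause D → Step S (D ∷ S)

data Run {n : ℕ} : Config n → Set where
  done : ∀ {S} → [] ∈ S → Run S
  step : ∀ {S S'} → Step S S' → Run S' → Run S

space : ∀ {n} {S : Config n} → Run S → ℕ
space (done {S} _)   = length S
space (step {S} _ r) = length S ⊔ space r

SpaceRefutation : ℕ → Set
SpaceRefutation n = Run {n} []

{-# OPTIONS --safe #-}
module Submission where

-- A linear order on [n] satisfies every axiom of Ordering_n except the one saying that its minimum i
-- has a predecessor.  Moving a set S ∌ i to the front of the order (and reversing it there) changes
-- the value of every linear form by an amount that is F₂-linear in S.  Hence if the order solves a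
-- system Φ of linear equations with |Φ| + 2 ≤ n, the |Φ| + 1 < n homogeneous conditions (S i = 0, and
-- no equation of Φ changes) have a nonzero solution S, and moving S to the front gives i a
-- predecessor while still solving Φ: a small system of equations never refutes an axiom.
-- For a tree-like refutation, walk down while keeping the equations f = α chosen at resolution steps
-- solvable by a linear order; where both choices are solvable, both subtrees are explored with one
-- more equation, so n − 2 equations force 2^(n−2) nodes.  For space, keep a linear order satisfying
-- one chosen equation of each clause in memory; with fewer than n − 1 clauses any new axiom can be
-- satisfied as well, so the empty clause never appears.

open import Algebra.Bundles using (CommutativeMonoid; CommutativeRing)
open import Data.Bool as Bool using (Bool; true; false; not; _∧_; _xor_; if_then_else_)
open import Data.Bool.Properties
  using (xor-∧-commutativeRing; xor-assoc; xor-identityʳ; xor-same; ¬-not; not-¬; not-involutive;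
         ∧-distribˡ-xor; ∧-distribʳ-xor; if-eta)
open import Data.Fin as Fin using (Fin; zero; suc; _≟_; punchIn)
open import Data.Fin.Properties using (punchInᵢ≢i; _<?_; <-cmp; <-trans)
open import Data.List using (List; []; _∷_; foldr; tabulate; length; map)
open import Data.List.Properties using (length-map; length-removeAt′)
open import Data.List.Membership.Propositional using (_∈_; find; lose)
open import Data.List.Membership.Propositional.Properties using (∈-map⁺; ∈-filter⁺; ∈-allFin)
open import Data.List.Relation.Binary.Pointwise using (Pointwise; []; _∷_; Pointwise-length)
open import Data.List.Relation.Binary.Subset.Propositional using (_⊆_)
open import Data.List.Relation.Binary.Subset.Propositional.Properties using (Any-resp-⊆)
open import Data.List.Relation.Unary.All as All using (All; []; _∷_)
open import Data.List.Relation.Unary.All.Properties using (¬Any⇒All¬; ─⁻; map⁻; ++⁺; ++⁻ˡ; ++⁻ʳ)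
open import Data.List.Relation.Unary.Any as Any using (here; there; any?; _─_)
open import Data.List.Relation.Unary.Any.Properties using (lookup-result)
open import Data.Nat using (ℕ; zero; suc; _+_; _∸_; _^_; _≤_; _<_; z≤n; s≤s; s≤s⁻¹; _≤?_)
open import Data.Nat.Properties
  using (≤-trans; ≤-reflexive; +-identityʳ; +-suc; +-mono-≤; m≤m+n; m≤n+m; m≤n⇒m≤1+n; n≤1+n;
         m≤n⇒m≤o⊔n; m≤n⇒m≤n⊔o; ∸-monoˡ-≤; ∸-monoʳ-≤; ≮⇒≥)
open import Data.Product using (_×_; _,_; ∃-syntax; proj₁; proj₂)
open import Data.Sum using (_⊎_; inj₁; inj₂)
open import Data.Vec using (lookup)
open import Data.Vec.Properties using (lookup∘tabulate)
open import Data.Vec.Functional using (Vector; zipWith; replicate) renaming (_∷_ to _∷ᵥ_)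
open import Function using (_∘_; id)
open import Relation.Binary.Definitions using (tri<; tri≈; tri>)
open import Relation.Binary.PropositionalEquality as ≡
  using (_≡_; _≢_; _≗_; refl; sym; cong; cong₂; subst; module ≡-Reasoning)
open import Relation.Nullary using (¬_; ¬?; does; yes; no; contradiction)
open import Relation.Nullary.Decidable using (dec-true; dec-false; decidable-stable)

open import Defs
open ≡-Reasoning

xor-commutativeMonoid : CommutativeMonoid _ _
xor-commutativeMonoid = CommutativeRing.+-commutativeMonoid xor-∧-commutativeRing

open import Algebra.Properties.CommutativeMonoid.Sum xor-commutativeMonoid
  using (sum; sum-syntax; ∑-distrib-+; sum-cong-≗; sum-remove; sum-replicate-zero)
open import Algebra.Properties.CommutativeSemigroup
  (CommutativeMonoid.commutativeSemigroup xor-commutativeMonoid) using (interchange)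

sum-delta : ∀ {n} (t : Vector Bool n) (i : Fin n) → (∀ j → j ≢ i → t j ≡ false) → sum t ≡ t i
sum-delta {suc n} t i off = begin
  sum t                            ≡⟨ sum-remove {i = i} t ⟩
  t i xor sum (t ∘ punchIn i)     ≡⟨ cong (t i xor_) (≡.trans (sum-cong-≗ (λ j → off _ (punchInᵢ≢i i j))) (sum-replicate-zero n)) ⟩
  t i xor false                    ≡⟨ xor-identityʳ (t i) ⟩
  t i                              ∎

foldr-xor : ∀ {A : Set} (c : A → Bool → Bool) (h : A → Bool) → (∀ x acc → c x acc ≡ h x xor acc) →
            ∀ {k} (g : Fin k → A) z → foldr c z (tabulate g) ≡ (∑[ r < k ] h (g r)) xor z
foldr-xor c h c-step {zero}  g z = refl
foldr-xor c h c-step {suc k} g z = begin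
  c (g zero) (foldr c z (tabulate (g ∘ suc)))      ≡⟨ c-step (g zero) _ ⟩
  h (g zero) xor foldr c z (tabulate (g ∘ suc))    ≡⟨ cong (h (g zero) xor_) (foldr-xor c h c-step (g ∘ suc) z) ⟩
  h (g zero) xor (∑[ r < k ] h (g (suc r)) xor z)  ≡⟨ xor-assoc (h (g zero)) _ z ⟨
  (∑[ r < suc k ] h (g r)) xor z                   ∎

term : ∀ {n} → Form n → Assign n → Fin n → Fin n → Bool
term f a i j = if does (i ≟ j) then false else (coef f i j ∧ a i j)

eval-sum : ∀ {n} (f : Form n) (a : Assign n) → eval f a ≡ ∑[ i < n ] ∑[ j < n ] term f a i j
eval-sum f a = ≡.trans
  (foldr-xor _ _ (λ i acc → foldr-xor _ (term f a i) (λ j acc′ → refl) id acc) id false)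
  (xor-identityʳ _)

eval-cong : ∀ {n} (f : Form n) {a b : Assign n} → (∀ i j → a i j ≡ b i j) → eval f a ≡ eval f b
eval-cong {n} f {a} {b} a≗b = begin
  eval f a                         ≡⟨ eval-sum f a ⟩
  ∑[ i < n ] ∑[ j < n ] term f a i j ≡⟨ sum-cong-≗ (λ i → sum-cong-≗ (λ j → term-cong i j)) ⟩
  ∑[ i < n ] ∑[ j < n ] term f b i j ≡⟨ eval-sum f b ⟨
  eval f b                         ∎
  where
  term-cong : ∀ i j → term f a i j ≡ term f b i j
  term-cong i j = cong (λ v → if does (i ≟ j) then false else (coef f i j ∧ v)) (a≗b i j)

_⊕²_ : ∀ {n} → Assign n → Assign n → Assign n
(a ⊕² b) i j = a i j xor b i j

eval-⊕² : ∀ {n} (f : Form n) (a b : Assign n) → eval f (a ⊕² b) ≡ eval f a xor eval f b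
eval-⊕² {n} f a b = begin
  eval f (a ⊕² b)                                                      ≡⟨ eval-sum f (a ⊕² b) ⟩
  ∑[ i < n ] ∑[ j < n ] term f (a ⊕² b) i j                             ≡⟨ sum-cong-≗ (λ i → sum-cong-≗ (term-⊕ i)) ⟩
  ∑[ i < n ] ∑[ j < n ] (term f a i j xor term f b i j)               ≡⟨ sum-cong-≗ (λ i → ∑-distrib-+ (term f a i) (term f b i)) ⟩
  ∑[ i < n ] (∑[ j < n ] term f a i j xor ∑[ j < n ] term f b i j)    ≡⟨ ∑-distrib-+ (λ i → ∑[ j < n ] term f a i j) (λ i → ∑[ j < n ] term f b i j) ⟩
  ∑[ i < n ] ∑[ j < n ] term f a i j xor ∑[ i < n ] ∑[ j < n ] term f b i j ≡⟨ cong₂ _xor_ (eval-sum f a) (eval-sum f b) ⟨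
  eval f a xor eval f b                                               ∎
  where
  term-⊕ : ∀ i j → term f (a ⊕² b) i j ≡ term f a i j xor term f b i j
  term-⊕ i j with does (i ≟ j)
  ... | true  = refl
  ... | false = ∧-distribˡ-xor (coef f i j) (a i j) (b i j)

coef-var : ∀ {n} (i j x y : Fin n) → coef (var i j) x y ≡ does (x ≟ i) ∧ does (y ≟ j)
coef-var i j x y = ≡.trans (cong (λ row → lookup row y) (lookup∘tabulate _ x)) (lookup∘tabulate _ y)

term-vanishes : ∀ {n} (f : Form n) (a : Assign n) {x y} → coef f x y ≡ false → term f a x y ≡ false
term-vanishes f a {x} {y} c≡0 rewrite c≡0 = if-eta (does (x ≟ y))

eval-var : ∀ {n} {i j : Fin n} (a : Assign n) → i ≢ j → eval (var i j) a ≡ a i j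
eval-var {n} {i} {j} a i≢j = begin
  eval (var i j) a                             ≡⟨ eval-sum (var i j) a ⟩
  ∑[ x < n ] ∑[ y < n ] term (var i j) a x y   ≡⟨ sum-delta _ i (λ x x≢i → row-vanishes x≢i) ⟩
  ∑[ y < n ] term (var i j) a i y              ≡⟨ sum-delta _ j (λ y y≢j → entry-vanishes (cong₂ _∧_ i≟i (dec-false (y ≟ j) y≢j))) ⟩
  term (var i j) a i j                         ≡⟨ cong (if_then false else (coef (var i j) i j ∧ a i j)) (dec-false (i ≟ j) i≢j) ⟩
  coef (var i j) i j ∧ a i j                   ≡⟨ cong (_∧ a i j) (≡.trans (coef-var i j i j) (cong₂ _∧_ i≟i (dec-true (j ≟ j) refl))) ⟩
  a i j                                        ∎
  where
  i≟i : does (i ≟ i) ≡ true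
  i≟i = dec-true (i ≟ i) refl
  entry-vanishes : ∀ {x y} → does (x ≟ i) ∧ does (y ≟ j) ≡ false → term (var i j) a x y ≡ false
  entry-vanishes {x} {y} c≡0 = term-vanishes (var i j) a (≡.trans (coef-var i j x y) c≡0)
  row-vanishes : ∀ {x} → x ≢ i → ∑[ y < n ] term (var i j) a x y ≡ false
  row-vanishes {x} x≢i = ≡.trans
    (sum-cong-≗ (λ y → entry-vanishes (cong (_∧ does (y ≟ j)) (dec-false (x ≟ i) x≢i))))
    (sum-replicate-zero n)

_⊕_ : ∀ {m} → Vector Bool m → Vector Bool m → Vector Bool m
_⊕_ = zipWith _xor_

record Linear (m : ℕ) : Set where
  field
    apply      : Vector Bool m → Bool
    apply-cong : ∀ {S R} → S ≗ R → apply S ≡ apply R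
    apply-⊕    : ∀ S R → apply (S ⊕ R) ≡ apply S xor apply R
open Linear

coordinate : ∀ {m} → Fin m → Linear m
apply      (coordinate i) S     = S i
apply-cong (coordinate i) S≗R   = S≗R i
apply-⊕    (coordinate i) S R   = refl

e₀ : ∀ {m} → Vector Bool (suc m)
e₀ {m} = true ∷ᵥ replicate m false

apply-∷ : ∀ {m} (g : Linear (suc m)) → apply g e₀ ≡ true →
          ∀ c T → apply g (c ∷ᵥ T) ≡ c xor apply g (false ∷ᵥ T)
apply-∷ g g₀ false T = refl
apply-∷ g g₀ true  T = begin
  apply g (true ∷ᵥ T)                      ≡⟨ apply-cong g (λ { zero → refl ; (suc x) → refl }) ⟩
  apply g (e₀ ⊕ (false ∷ᵥ T))              ≡⟨ apply-⊕ g e₀ (false ∷ᵥ T) ⟩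
  apply g e₀ xor apply g (false ∷ᵥ T)      ≡⟨ cong (_xor apply g (false ∷ᵥ T)) g₀ ⟩
  true xor apply g (false ∷ᵥ T)            ∎

solve-pivot : ∀ {m} → Linear (suc m) → Vector Bool m → Vector Bool (suc m)
solve-pivot g T = apply g (false ∷ᵥ T) ∷ᵥ T

solve-pivot-root : ∀ {m} (g : Linear (suc m)) → apply g e₀ ≡ true → ∀ T → apply g (solve-pivot g T) ≡ false
solve-pivot-root g g₀ T = ≡.trans (apply-∷ g g₀ _ T) (xor-same (apply g (false ∷ᵥ T)))

solve-pivot-cong : ∀ {m} (g : Linear (suc m)) {S R} → S ≗ R → solve-pivot g S ≗ solve-pivot g R
solve-pivot-cong g S≗R zero    = apply-cong g λ { zero → refl ; (suc x) → S≗R x }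
solve-pivot-cong g S≗R (suc x) = S≗R x

solve-pivot-⊕ : ∀ {m} (g : Linear (suc m)) S R → solve-pivot g (S ⊕ R) ≗ solve-pivot g S ⊕ solve-pivot g R
solve-pivot-⊕ g S R zero    = ≡.trans (apply-cong g λ { zero → refl ; (suc x) → refl }) (apply-⊕ g (false ∷ᵥ S) (false ∷ᵥ R))
solve-pivot-⊕ g S R (suc x) = refl

eliminate : ∀ {m} → Linear (suc m) → Linear (suc m) → Linear m
apply      (eliminate g l) T   = apply l (solve-pivot g T)
apply-cong (eliminate g l) S≗R = apply-cong l (solve-pivot-cong g S≗R)
apply-⊕    (eliminate g l) S R = ≡.trans (apply-cong l (solve-pivot-⊕ g S R)) (apply-⊕ l (solve-pivot g S) (solve-pivot g R))

common-nonzero-root : ∀ {m} (ls : List (Linear m)) → length ls < m →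
                      ∃[ S ] (∃[ x ] S x ≡ true) × All (λ l → apply l S ≡ false) ls
common-nonzero-root {suc m} ls len with any? (λ l → apply l e₀ Bool.≟ true) ls
... | no no-pivot = e₀ , (zero , refl) , All.map ¬-not (¬Any⇒All¬ ls no-pivot)
... | yes p =
  let g = Any.lookup p
      T , (x , Tx) , zeros = common-nonzero-root (map (eliminate g) (ls ─ p)) shorter
  in solve-pivot g T , (suc x , Tx) , ─⁻ p (solve-pivot-root g (lookup-result p) T) (map⁻ zeros)
  where
  shorter : length (map (eliminate (Any.lookup p)) (ls ─ p)) < m
  shorter rewrite length-map (eliminate (Any.lookup p)) (ls ─ p) =
    subst (_≤ m) (length-removeAt′ ls (Any.index p)) (s≤s⁻¹ len)

-- front (S x) (S y) (a x y) is the new value of x_xy once S is moved to the front of a.  The order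
-- inside S is reversed: that makes the change, displacement a S, linear in S (keeping it would add
-- the quadratic term S x ∧ S y).
front : Bool → Bool → Bool → Bool
front true  true  b = not b
front true  false _ = true
front false true  _ = false
front false false b = b

front-xor : ∀ sx sy b → front sx sy b ≡ b xor ((sx ∧ not b) xor (sy ∧ b))
front-xor true  true  true  = refl
front-xor true  true  false = refl
front-xor true  false true  = refl
front-xor true  false false = refl
front-xor false true  true  = refl
front-xor false true  false = refl
front-xor false false true  = refl
front-xor false false false = refl

front-flip : ∀ sx sy b → front sy sx (not b) ≡ not (front sx sy b)
front-flip true  true  b = refl
front-flip true  false b = refl
front-flip false true  b = refl
front-flip false false b = refl

front-trans : ∀ sx sy sz {p q r} → (p ≡ true → q ≡ true → r ≡ true) → (p ≡ false → q ≡ false → r ≡ false) →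
              front sx sy p ≡ true → front sy sz q ≡ true → front sx sz r ≡ true
front-trans true  true  true  {true}          _ _  ()
front-trans true  true  true  {false} {true}  _ _  _  ()
front-trans true  true  true  {false} {false} _ ff _  _ = cong not (ff refl refl)
front-trans true  true  false                 _ _  _  _ = refl
front-trans true  false true                  _ _  _  ()
front-trans true  false false                 _ _  _  _ = refl
front-trans false true  _                     _ _  ()
front-trans false false true                  _ _  _  ()
front-trans false false false                 tt _ = tt

record IsLinearOrder {n} (a : Assign n) : Set where
  field
    flip       : ∀ {x y} → x ≢ y → a y x ≡ not (a x y)
    transitive : ∀ {x y z} → x ≢ y → y ≢ z → x ≢ z → a x y ≡ true → a y z ≡ true → a x z ≡ true
open IsLinearOrder

transitive-false : ∀ {n} {a : Assign n} → IsLinearOrder a → ∀ {x y z} → x ≢ y → y ≢ z → x ≢ z →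
                   a x y ≡ false → a y z ≡ false → a x z ≡ false
transitive-false {a = a} lo {x} {y} {z} x≢y y≢z x≢z axy ayz = begin
  a x z              ≡⟨ not-involutive (a x z) ⟨
  not (not (a x z))  ≡⟨ cong not (flip lo x≢z) ⟨
  not (a z x)        ≡⟨ cong not (transitive lo (y≢z ∘ sym) (x≢y ∘ sym) (x≢z ∘ sym)
                                    (≡.trans (flip lo y≢z) (cong not ayz)) (≡.trans (flip lo x≢y) (cong not axy))) ⟩
  false              ∎

moveToFront : ∀ {n} → Assign n → Vector Bool n → Assign n
moveToFront a S x y = front (S x) (S y) (a x y)

moveToFront-isLinearOrder : ∀ {n} {a : Assign n} S → IsLinearOrder a → IsLinearOrder (moveToFront a S)
flip       (moveToFront-isLinearOrder {a = a} S lo) {x} {y} x≢y rewrite flip lo x≢y = front-flip (S x) (S y) (a x y)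
transitive (moveToFront-isLinearOrder {a = a} S lo) {x} {y} {z} x≢y y≢z x≢z =
  front-trans (S x) (S y) (S z) (transitive lo x≢y y≢z x≢z) (transitive-false lo x≢y y≢z x≢z)

displacement : ∀ {n} → Assign n → Vector Bool n → Assign n
displacement a S x y = (S x ∧ not (a x y)) xor (S y ∧ a x y)

moveToFront-eval : ∀ {n} (f : Form n) (a : Assign n) S →
                   eval f (moveToFront a S) ≡ eval f a xor eval f (displacement a S)
moveToFront-eval f a S = ≡.trans (eval-cong f (λ x y → front-xor (S x) (S y) (a x y))) (eval-⊕² f a (displacement a S))

displacement-⊕ : ∀ {n} (a : Assign n) S R x y →
                 displacement a (S ⊕ R) x y ≡ (displacement a S ⊕² displacement a R) x y
displacement-⊕ a S R x y = ≡.trans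
  (cong₂ _xor_ (∧-distribʳ-xor (not (a x y)) (S x) (R x)) (∧-distribʳ-xor (a x y) (S y) (R y)))
  (interchange (S x ∧ not (a x y)) (R x ∧ not (a x y)) (S y ∧ a x y) (R y ∧ a x y))

displacement-functional : ∀ {n} → Assign n → Form n → Linear n
apply      (displacement-functional a f) S     = eval f (displacement a S)
apply-cong (displacement-functional a f) S≗R   =
  eval-cong f (λ x y → cong₂ (λ u v → (u ∧ not (a x y)) xor (v ∧ a x y)) (S≗R x) (S≗R y))
apply-⊕    (displacement-functional a f) S R   =
  ≡.trans (eval-cong f (displacement-⊕ a S R)) (eval-⊕² f (displacement a S) (displacement a R))

Solves : ∀ {n} → Assign n → List (Eqn n) → Set
Solves a Φ = All (λ e → eval (proj₁ e) a ≡ proj₂ e) Φ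

HasPredecessor : ∀ {n} → Assign n → Fin n → Set
HasPredecessor a i = ∃[ j ] j ≢ i × a j i ≡ true

order-with-predecessor : ∀ {n} {a : Assign n} {Φ} → IsLinearOrder a → Solves a Φ → 2 + length Φ ≤ n →
                         ∀ i → ∃[ b ] IsLinearOrder b × Solves b Φ × HasPredecessor b i
order-with-predecessor {n} {a} {Φ} lo sol len i
  with S , (x , Sx) , Si ∷ fixed ← common-nonzero-root (coordinate i ∷ map (displacement-functional a ∘ proj₁) Φ)
                                     (subst (λ k → 2 + k ≤ n) (sym (length-map _ Φ)) len)
  = moveToFront a S , moveToFront-isLinearOrder S lo , All.zipWith (λ {e} → still-solves {e}) (sol , map⁻ fixed) ,
    x , x≢i , cong₂ (λ u v → front u v (a x i)) Sx Si
  where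
  x≢i : x ≢ i
  x≢i x≡i = contradiction (≡.trans (sym Sx) (≡.trans (cong S x≡i) Si)) λ ()
  still-solves : ∀ {e} → eval (proj₁ e) a ≡ proj₂ e × eval (proj₁ e) (displacement a S) ≡ false →
                 eval (proj₁ e) (moveToFront a S) ≡ proj₂ e
  still-solves {f , α} (fa≡α , fd≡0) = begin
    eval f (moveToFront a S)                        ≡⟨ moveToFront-eval f a S ⟩
    eval f a xor eval f (displacement a S)          ≡⟨ cong₂ _xor_ fa≡α fd≡0 ⟩
    α xor false                                     ≡⟨ xor-identityʳ α ⟩
    α                                               ∎

ascending : ∀ {n} → Assign n
ascending x y = does (x <? y)

ascending-isLinearOrder : ∀ {n} → IsLinearOrder (ascending {n})
flip ascending-isLinearOrder {x} {y} x≢y with <-cmp x y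
... | tri< x<y _ y≮x rewrite dec-true (x <? y) x<y | dec-false (y <? x) y≮x = refl
... | tri≈ _ x≡y _   = contradiction x≡y x≢y
... | tri> x≮y _ y<x rewrite dec-false (x <? y) x≮y | dec-true (y <? x) y<x = refl
transitive ascending-isLinearOrder {x = x} {y} {z} _ _ _ x<y y<z =
  dec-true (x <? z) (<-trans (ascending-< x<y) (ascending-< y<z))
  where
  ascending-< : ∀ {u v} → ascending u v ≡ true → u Fin.< v
  ascending-< {u} {v} uv with u <? v
  ... | yes u<v = u<v
  ... | no  u≮v = contradiction (≡.trans (sym uv) (dec-false (u <? v) u≮v)) λ ()

satisfied-unless-minimum : ∀ {n} {a : Assign n} {C} → IsLinearOrder a → Ordering C →
                           Sat a C ⊎ ∃[ i ] (∀ {b} → HasPredecessor b i → Sat b C)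
satisfied-unless-minimum {a = a} lo (antisym i j i≢j) with a i j in aij
... | false = inj₁ (here (≡.trans (eval-var a i≢j) aij))
... | true  = inj₁ (there (here (≡.trans (eval-var a (i≢j ∘ sym)) (≡.trans (flip lo i≢j) (cong not aij)))))
satisfied-unless-minimum {a = a} lo (total i j i≢j) with a i j in aij
... | true  = inj₁ (here (≡.trans (eval-var a i≢j) aij))
... | false = inj₁ (there (here (≡.trans (eval-var a (i≢j ∘ sym)) (≡.trans (flip lo i≢j) (cong not aij)))))
satisfied-unless-minimum {a = a} lo (trans i j k i≢j j≢k i≢k) with a i j in aij | a j k in ajk
... | false | _     = inj₁ (here (≡.trans (eval-var a i≢j) aij))
... | true  | false = inj₁ (there (here (≡.trans (eval-var a j≢k) ajk)))
... | true  | true  = inj₁ (there (there (here (≡.trans (eval-var a i≢k) (transitive lo i≢j j≢k i≢k aij ajk)))))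
satisfied-unless-minimum lo (nomin i) = inj₂ (i , λ { {b} (j , j≢i , bji) →
  lose (∈-map⁺ (λ j → pos j i) (∈-filter⁺ (λ j → ¬? (j ≟ i)) (∈-allFin j) j≢i)) (≡.trans (eval-var b j≢i) bji) })

satisfy-axiom : ∀ {n} {a : Assign n} {Φ C} → IsLinearOrder a → Solves a Φ → 2 + length Φ ≤ n → Ordering C →
                ∃[ b ] IsLinearOrder b × Solves b Φ × Sat b C
satisfy-axiom {a = a} lo sol len ax with satisfied-unless-minimum lo ax
... | inj₁ sat = a , lo , sol , sat
... | inj₂ (i , needs-predecessor) with order-with-predecessor lo sol len i
...   | b , lo′ , sol′ , pred = b , lo′ , sol′ , needs-predecessor pred

sat-branch : ∀ {n} {a : Assign n} {f β C D} → C ⊆ (f , β) ∷ D → eval f a ≡ not β → Sat a C → Sat a D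
sat-branch C⊆ fa sat with Any-resp-⊆ C⊆ sat
... | here fa≡β = contradiction (≡.trans (sym fa≡β) fa) (not-¬ refl)
... | there sat′ = sat′

res-sound : ∀ {n} {a : Assign n} {f C₁ C₂ D} → ResStep f C₁ C₂ D → Sat a C₁ → Sat a C₂ → Sat a D
res-sound {a = a} {f} st sat₁ sat₂ with eval f a in fa
... | true  = sat-branch (ResStep.C₁⊆ st) fa sat₁
... | false = sat-branch (ResStep.C₂⊆ st) fa sat₂

Consistent : ∀ {n} → List (Eqn n) → Set
Consistent {n} Φ = ∃[ a ] IsLinearOrder {n} a × Solves a Φ

Falsifies : ∀ {n} → List (Eqn n) → Clause n → Set
Falsifies {n} Φ C = ∀ (a : Assign n) → IsLinearOrder a → Solves a Φ → ¬ Sat a C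

falsifies-branch : ∀ {n} {f β Φ} {C D : Clause n} → C ⊆ (f , β) ∷ D → Falsifies Φ D → Falsifies ((f , not β) ∷ Φ) C
falsifies-branch C⊆ fals a lo (fa ∷ sol) = fals a lo sol ∘ sat-branch C⊆ fa

falsifies-forced : ∀ {n} {f β Φ} {C D : Clause n} → C ⊆ (f , β) ∷ D → Falsifies Φ D →
                   ¬ Consistent ((f , β) ∷ Φ) → Falsifies Φ C
falsifies-forced {f = f} {β} C⊆ fals inconsistent a lo sol with eval f a Bool.≟ β
... | yes fa≡β = contradiction (a , lo , fa≡β ∷ sol) inconsistent
... | no  fa≢β = falsifies-branch C⊆ fals a lo (¬-not fa≢β ∷ sol)

size-positive : ∀ {n} {C : Clause n} (π : TreeDeriv C) → 1 ≤ size π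
size-positive (axiom _)    = s≤s z≤n
size-positive (res _ _ _)  = s≤s z≤n
size-positive (weak _ _ _) = s≤s z≤n

tree-bound : ∀ {n} {C : Clause n} {Φ} (π : TreeDeriv C) → Falsifies Φ C → Consistent Φ →
             ∀ k → 2 + (k + length Φ) ≤ n → 2 ^ k ≤ size π
tree-bound π _ _ zero _ = size-positive π
tree-bound {Φ = Φ} (axiom ax) fals (a , lo , sol) (suc k) len
  with b , lo′ , sol′ , sat ← satisfy-axiom lo sol (≤-trans (s≤s (s≤s (m≤n+m (length Φ) (suc k)))) len) ax
  = contradiction sat (fals b lo′ sol′)
tree-bound (weak π C⊨D _) fals cons (suc k) len =
  m≤n⇒m≤1+n (tree-bound π (λ a lo sol → fals a lo sol ∘ C⊨D a) cons (suc k) len)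
tree-bound {n} {Φ = Φ} (res {f} π₁ π₂ st) fals (a , lo , sol) (suc k) len =
  decidable-stable (2 ^ suc k ≤? size (res π₁ π₂ st)) ¬¬bound
  where
  Bound : Set
  Bound = 2 ^ suc k ≤ size (res π₁ π₂ st)
  both : Consistent ((f , true) ∷ Φ) → Consistent ((f , false) ∷ Φ) → Bound
  both cons₁ cons₂ = m≤n⇒m≤1+n (+-mono-≤
    (tree-bound π₁ (falsifies-branch (ResStep.C₁⊆ st) fals) cons₁ k len′)
    (≤-trans (≤-reflexive (+-identityʳ (2 ^ k))) (tree-bound π₂ (falsifies-branch (ResStep.C₂⊆ st) fals) cons₂ k len′)))
    where
    len′ : 2 + (k + suc (length Φ)) ≤ n
    len′ = subst (λ m → 2 + m ≤ n) (sym (+-suc k (length Φ))) len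
  only₁ : ¬ Consistent ((f , false) ∷ Φ) → Bound
  only₁ inconsistent = m≤n⇒m≤1+n (≤-trans
    (tree-bound π₁ (falsifies-forced (ResStep.C₁⊆ st) fals inconsistent) (a , lo , sol) (suc k) len)
    (m≤m+n (size π₁) (size π₂)))
  only₂ : ¬ Consistent ((f , true) ∷ Φ) → Bound
  only₂ inconsistent = m≤n⇒m≤1+n (≤-trans
    (tree-bound π₂ (falsifies-forced (ResStep.C₂⊆ st) fals inconsistent) (a , lo , sol) (suc k) len)
    (m≤n+m (size π₂) (size π₁)))
  -- Which of Φ + (f = 1), Φ + (f = 0) is consistent is not decidable; since Bound is, argue classically.
  ¬¬bound : ¬ ¬ Bound
  ¬¬bound ¬bound with eval f a in fa
  ... | true  = ¬bound (only₁ λ cons₂ → ¬bound (both (a , lo , fa ∷ sol) cons₂))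
  ... | false = ¬bound (only₂ λ cons₁ → ¬bound (both cons₁ (a , lo , fa ∷ sol)))

Model : ∀ {n} → Config n → Set
Model {n} S = ∃[ a ] IsLinearOrder {n} a × All (Sat a) S

pick-satisfied : ∀ {n} {a : Assign n} {S : Config n} → All (Sat a) S → ∃[ Φ ] Pointwise _∈_ Φ S × Solves a Φ
pick-satisfied [] = [] , [] , []
pick-satisfied (sat ∷ sats) with e , e∈C , e-holds ← find sat | Φ , Φ∈S , sol ← pick-satisfied sats
  = e ∷ Φ , e∈C ∷ Φ∈S , e-holds ∷ sol

satisfies-picked : ∀ {n} {b : Assign n} {Φ S} → Pointwise _∈_ Φ S → Solves b Φ → All (Sat b) S
satisfies-picked []             []            = []
satisfies-picked (e∈C ∷ Φ∈S) (e-holds ∷ sol) = lose e∈C e-holds ∷ satisfies-picked Φ∈S sol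

step-preserves-model : ∀ {n} {S S′ : Config n} → Step S S′ → 2 + length S ≤ n → Model S → Model S′
step-preserves-model {n} (addAx ax) len (a , lo , sat)
  with Φ , Φ∈S , sol ← pick-satisfied sat
  with b , lo′ , sol′ , satC ← satisfy-axiom lo sol (subst (λ m → 2 + m ≤ n) (sym (Pointwise-length Φ∈S)) len) ax
  = b , lo′ , satC ∷ satisfies-picked Φ∈S sol′
step-preserves-model (delete S₁ S₂ C) _ (a , lo , sat) = a , lo , ++⁺ (++⁻ˡ S₁ sat) (All.tail (++⁻ʳ S₁ sat))
step-preserves-model (addRes C₁∈S C₂∈S st) _ (a , lo , sat) =
  a , lo , res-sound st (All.lookup sat C₁∈S) (All.lookup sat C₂∈S) ∷ sat
step-preserves-model (addWk C∈S C⊨D _) _ (a , lo , sat) = a , lo , C⊨D a (All.lookup sat C∈S) ∷ sat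

space-bound : ∀ {n} {S : Config n} (ρ : Run S) → Model S → n ∸ 1 ≤ space ρ
space-bound (done []∈S) (a , _ , sat) = contradiction (All.lookup sat []∈S) λ ()
space-bound {n} (step {S} s ρ) model with 2 + length S ≤? n
... | yes len = m≤n⇒m≤o⊔n (length S) (space-bound ρ (step-preserves-model s len model))
... | no ¬len = m≤n⇒m≤n⊔o (space ρ) (∸-monoˡ-≤ 1 (≮⇒≥ ¬len))

tree-lower-bound : ∀ {n} (π : TreeRefutation n) → 2 ^ (n ∸ 2) ≤ size π
tree-lower-bound {zero}        π = size-positive π
tree-lower-bound {suc zero}    π = size-positive π
tree-lower-bound {suc (suc m)} π =
  tree-bound π (λ _ _ _ ()) (ascending , ascending-isLinearOrder , []) m (s≤s (s≤s (≤-reflexive (+-identityʳ m))))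

space-lower-bound : ∀ {n} (ρ : SpaceRefutation n) → n ∸ 1 ≤ space ρ
space-lower-bound ρ = space-bound ρ (ascending , ascending-isLinearOrder , [])

theorem3p6 : (n : ℕ) →
    ((π : TreeRefutation n) → 2 ^ (n ∸ 2) ≤ size π) ×
    ((ρ : SpaceRefutation n) → n ∸ 2 ≤ space ρ)
theorem3p6 n = tree-lower-bound , λ ρ → ≤-trans (∸-monoʳ-≤ n (n≤1+n 1)) (space-lower-bound ρ)
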